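{- Let $M$ be a lattice in the variety $\mathcal{M}_\omega$ and let $a_0,a_1,b_0,b_1,a'_0,a'_1,b'_0,b'_1\in M$ satisfy: $a_i\leq a'_i$ and $b'_i=b_i\vee a_0\vee a_1$ for all $i\in\{0,1\}$; $b_0\wedge b_1\leq a_0\vee a_1$; and $b'_0\wedge b'_1\leq a'_0\vee a'_1$. Set $a^*_i=a'_i\wedge b'_0\wedge b'_1$ for each $i\in\{0,1\}$. Then $a^*_0\vee a^*_1=b'_0\wedge b'_1$.
   Context: $\mathcal{M}_\omega$ denotes the lattice variety generated by all lattices of length $2$ (equivalently, by the lattice $\mathsf{M}_\omega$ of length $2$ with countably infinitely many atoms). -}

module Defs where

open import Level using (Level)
open import Data.Nat using (ℕ; _≡ᵇ_)
open import Data.Bool using (if_then_else_)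
open import Relation.Binary.PropositionalEquality using (_≡_)
open import Algebra.Lattice.Bundles using (Lattice)

infixr 7 _∧ₜ_
infixr 6 _∨ₜ_
data Term : Set where
  var   : ℕ → Term
  _∨ₜ_  : Term → Term → Term
  _∧ₜ_  : Term → Term → Term

eval : ∀ {c ℓ} (L : Lattice c ℓ) → (ℕ → Lattice.Carrier L) → Term → Lattice.Carrier L
eval L ρ (var i)  = ρ i
eval L ρ (s ∨ₜ t) = Lattice._∨_ L (eval L ρ s) (eval L ρ t)
eval L ρ (s ∧ₜ t) = Lattice._∧_ L (eval L ρ s) (eval L ρ t)

data Mω : Set where
  bot  : Mω
  top  : Mω
  atom : ℕ → Mω

_∨ω_ : Mω → Mω → Mω
bot ∨ω y = y
top ∨ω y = top
atom i ∨ω bot = atom i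
atom i ∨ω top = top
atom i ∨ω atom j = if i ≡ᵇ j then atom i else top

_∧ω_ : Mω → Mω → Mω
bot ∧ω y = bot
top ∧ω y = y
atom i ∧ω bot = bot
atom i ∧ω top = atom i
atom i ∧ω atom j = if i ≡ᵇ j then atom i else bot

evalω : (ℕ → Mω) → Term → Mω
evalω ρ (var i)  = ρ i
evalω ρ (s ∨ₜ t) = evalω ρ s ∨ω evalω ρ t
evalω ρ (s ∧ₜ t) = evalω ρ s ∧ω evalω ρ t

HoldsInMω : Term → Term → Set
HoldsInMω s t = ∀ (ρ : ℕ → Mω) → evalω ρ s ≡ evalω ρ t

HoldsIn : ∀ {c ℓ} (L : Lattice c ℓ) → Term → Term → Set _
HoldsIn L s t = ∀ (ρ : ℕ → Lattice.Carrier L) → Lattice._≈_ L (eval L ρ s) (eval L ρ t)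

-- L belongs to the variety 𝓜_ω generated by M_ω:
-- every lattice identity valid in M_ω is valid in L (Birkhoff: HSP(M_ω) = Mod(Id(M_ω)))
InMω : ∀ {c ℓ} (L : Lattice c ℓ) → Set _
InMω L = ∀ (s t : Term) → HoldsInMω s t → HoldsIn L s t

Leq : ∀ {c ℓ} (L : Lattice c ℓ) → Lattice.Carrier L → Lattice.Carrier L → Set ℓ
Leq L x y = Lattice._≈_ L (Lattice._∧_ L x y) x

-- In a lattice of length 2 every element is ⊥, ⊤ or an atom, and the identity
--   u ∧ (p₀ ∨ p₁) ≤ (p₀ ∧ u) ∨ (p₁ ∧ u) ∨ (b₀ ∧ b₁)
-- holds whenever Aᵢ ≤ pᵢ, Aᵢ ≤ u and u ≤ bᵢ ∨ A₀ ∨ A₁: it is distributivity unless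
-- u is an atom below neither pᵢ, and then A₀ = A₁ = ⊥ forces u ≤ b₀ ∧ b₁.
-- Writing Aᵢ = aᵢ ∧ pᵢ turns it into a lattice identity, so it holds throughout 𝓜_ω.
-- With pᵢ = a'ᵢ and u = b'₀ ∧ b'₁ ≤ a'₀ ∨ a'₁ it gives u ≤ a*₀ ∨ a*₁ ∨ (b₀ ∧ b₁), and
-- b₀ ∧ b₁ ≤ a₀ ∨ a₁ ≤ a*₀ ∨ a*₁ absorbs the last joinand.
module Submission where

open import Defs
open import Algebra.Lattice.Bundles using (Lattice)
import Algebra.Lattice.Properties.Lattice as LatticeProperties
import Relation.Binary.Lattice as OrderLattice
import Relation.Binary.Reasoning.PartialOrder as PosetReasoning
open import Data.Bool using (true; false)
open import Data.Nat using (ℕ; zero; suc; _≡ᵇ_; _≟_)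
open import Data.Product using (∃; _×_; _,_)
open import Data.Sum using (_⊎_; inj₁; inj₂)
open import Function using (_$_)
open import Relation.Binary.Bundles using (Poset)
open import Relation.Binary.PropositionalEquality using (_≡_; _≢_; refl; cong)
  renaming (sym to ≡-sym)
open import Relation.Nullary using (Dec; yes; no; ¬_; contradiction)

≡ᵇ-refl : ∀ n → (n ≡ᵇ n) ≡ true
≡ᵇ-refl zero    = refl
≡ᵇ-refl (suc n) = ≡ᵇ-refl n

≢⇒≡ᵇ≡false : ∀ {m n} → m ≢ n → (m ≡ᵇ n) ≡ false
≢⇒≡ᵇ≡false {zero}  {zero}  m≢n = contradiction refl m≢n
≢⇒≡ᵇ≡false {zero}  {suc n} m≢n = refl
≢⇒≡ᵇ≡false {suc m} {zero}  m≢n = refl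
≢⇒≡ᵇ≡false {suc m} {suc n} m≢n = ≢⇒≡ᵇ≡false (λ m≡n → m≢n (cong suc m≡n))

infix 4 _≤ω_
data _≤ω_ : Mω → Mω → Set where
  bot≤ : ∀ {x} → bot ≤ω x
  ≤top : ∀ {x} → x ≤ω top
  atom≤atom : ∀ {i} → atom i ≤ω atom i

≤ω-refl : ∀ x → x ≤ω x
≤ω-refl bot      = bot≤
≤ω-refl top      = ≤top
≤ω-refl (atom i) = atom≤atom

≤ω-trans : ∀ {x y z} → x ≤ω y → y ≤ω z → x ≤ω z
≤ω-trans bot≤      _    = bot≤
≤ω-trans ≤top      ≤top = ≤top
≤ω-trans atom≤atom y≤z  = y≤z

≤ω-bot⇒≡bot : ∀ {x} → x ≤ω bot → x ≡ bot
≤ω-bot⇒≡bot bot≤ = refl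

_≤ω?_ : ∀ x y → Dec (x ≤ω y)
bot    ≤ω? y      = yes bot≤
x      ≤ω? top    = yes ≤top
top    ≤ω? bot    = no λ ()
top    ≤ω? atom j = no λ ()
atom i ≤ω? bot    = no λ ()
atom i ≤ω? atom j with i ≟ j
... | yes refl = yes atom≤atom
... | no  i≢j  = no λ { atom≤atom → i≢j refl }

x≤ωx∨ωy : ∀ x y → x ≤ω x ∨ω y
x≤ωx∨ωy bot      y        = bot≤
x≤ωx∨ωy top      y        = ≤top
x≤ωx∨ωy (atom i) bot      = atom≤atom
x≤ωx∨ωy (atom i) top      = ≤top
x≤ωx∨ωy (atom i) (atom j) with i ≡ᵇ j
... | true  = atom≤atom
... | false = ≤top

y≤ωx∨ωy : ∀ x y → y ≤ω x ∨ω y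
y≤ωx∨ωy bot      y        = ≤ω-refl y
y≤ωx∨ωy top      y        = ≤top
y≤ωx∨ωy (atom i) bot      = bot≤
y≤ωx∨ωy (atom i) top      = ≤top
y≤ωx∨ωy (atom i) (atom j) with i ≟ j
... | yes refl rewrite ≡ᵇ-refl i   = atom≤atom
... | no  i≢j  rewrite ≢⇒≡ᵇ≡false i≢j = ≤top

∨ω-least : ∀ {x y z} → x ≤ω z → y ≤ω z → x ∨ω y ≤ω z
∨ω-least bot≤                y≤z       = y≤z
∨ω-least ≤top                y≤z       = ≤top
∨ω-least atom≤atom           bot≤      = atom≤atom
∨ω-least (atom≤atom {i})     atom≤atom rewrite ≡ᵇ-refl i = atom≤atom

x∧ωy≤ωx : ∀ x y → x ∧ω y ≤ω x
x∧ωy≤ωx bot      y        = bot≤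
x∧ωy≤ωx top      y        = ≤top
x∧ωy≤ωx (atom i) bot      = bot≤
x∧ωy≤ωx (atom i) top      = atom≤atom
x∧ωy≤ωx (atom i) (atom j) with i ≡ᵇ j
... | true  = atom≤atom
... | false = bot≤

x∧ωy≤ωy : ∀ x y → x ∧ω y ≤ω y
x∧ωy≤ωy bot      y        = bot≤
x∧ωy≤ωy top      y        = ≤ω-refl y
x∧ωy≤ωy (atom i) bot      = bot≤
x∧ωy≤ωy (atom i) top      = ≤top
x∧ωy≤ωy (atom i) (atom j) with i ≟ j
... | yes refl rewrite ≡ᵇ-refl i   = atom≤atom
... | no  i≢j  rewrite ≢⇒≡ᵇ≡false i≢j = bot≤

∧ω-greatest : ∀ {x y z} → x ≤ω y → x ≤ω z → x ≤ω y ∧ω z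
∧ω-greatest bot≤            x≤z       = bot≤
∧ω-greatest ≤top            x≤z       = x≤z
∧ω-greatest atom≤atom       ≤top      = atom≤atom
∧ω-greatest (atom≤atom {i}) atom≤atom rewrite ≡ᵇ-refl i = atom≤atom

x≤ωy⇒x∧ωy≡x : ∀ {x y} → x ≤ω y → x ∧ω y ≡ x
x≤ωy⇒x∧ωy≡x bot≤                 = refl
x≤ωy⇒x∧ωy≡x {bot}    ≤top        = refl
x≤ωy⇒x∧ωy≡x {top}    ≤top        = refl
x≤ωy⇒x∧ωy≡x {atom i} ≤top        = refl
x≤ωy⇒x∧ωy≡x (atom≤atom {i}) rewrite ≡ᵇ-refl i = refl

x∨ωbot≡x : ∀ x → x ∨ω bot ≡ x
x∨ωbot≡x bot      = refl
x∨ωbot≡x top      = refl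
x∨ωbot≡x (atom i) = refl

x∧ωtop≡x : ∀ x → x ∧ω top ≡ x
x∧ωtop≡x bot      = refl
x∧ωtop≡x top      = refl
x∧ωtop≡x (atom i) = refl

x∨ωy≤ωx∨ω[y∨ωz] : ∀ x y z → x ∨ω y ≤ω x ∨ω (y ∨ω z)
x∨ωy≤ωx∨ω[y∨ωz] x y z =
  ∨ω-least (x≤ωx∨ωy x _) (≤ω-trans (x≤ωx∨ωy y z) (y≤ωx∨ωy x _))

≤ω-atom-and-≤ω-other⇒≡bot : ∀ {x k p} → x ≤ω atom k → x ≤ω p → ¬ atom k ≤ω p → x ≡ bot
≤ω-atom-and-≤ω-other⇒≡bot bot≤      _   _     = refl
≤ω-atom-and-≤ω-other⇒≡bot atom≤atom x≤p k≰p = contradiction x≤p k≰p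

∧ω-distribˡ-∨ω-or-atom : ∀ u p q →
  u ∧ω (p ∨ω q) ≤ω (p ∧ω u) ∨ω (q ∧ω u)
  ⊎ ∃ λ k → u ≡ atom k × ¬ atom k ≤ω p × ¬ atom k ≤ω q
∧ω-distribˡ-∨ω-or-atom bot p q = inj₁ bot≤
∧ω-distribˡ-∨ω-or-atom top p q rewrite x∧ωtop≡x p | x∧ωtop≡x q = inj₁ (≤ω-refl (p ∨ω q))
∧ω-distribˡ-∨ω-or-atom (atom k) p q with atom k ≤ω? p | atom k ≤ω? q
... | yes k≤p | _ = inj₁ $ ≤ω-trans (x∧ωy≤ωx (atom k) (p ∨ω q))
  (≤ω-trans (∧ω-greatest k≤p atom≤atom) (x≤ωx∨ωy (p ∧ω atom k) (q ∧ω atom k)))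
... | no _ | yes k≤q = inj₁ $ ≤ω-trans (x∧ωy≤ωx (atom k) (p ∨ω q))
  (≤ω-trans (∧ω-greatest k≤q atom≤atom) (y≤ωx∨ωy (p ∧ω atom k) (q ∧ω atom k)))
... | no k≰p | no k≰q = inj₂ (k , refl , k≰p , k≰q)

Mω-law : ∀ {A₀ A₁ b₀ b₁ p₀ p₁ u} →
  A₀ ≤ω p₀ → A₁ ≤ω p₁ → A₀ ≤ω u → A₁ ≤ω u →
  u ≤ω b₀ ∨ω (A₀ ∨ω A₁) → u ≤ω b₁ ∨ω (A₀ ∨ω A₁) →
  u ∧ω (p₀ ∨ω p₁) ≤ω (p₀ ∧ω u) ∨ω ((p₁ ∧ω u) ∨ω (b₀ ∧ω b₁))
Mω-law {A₀} {A₁} {b₀} {b₁} {p₀} {p₁} {u} A₀≤p₀ A₁≤p₁ A₀≤u A₁≤u u≤b₀∨A u≤b₁∨A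
  with ∧ω-distribˡ-∨ω-or-atom u p₀ p₁
... | inj₁ distrib = ≤ω-trans distrib (x∨ωy≤ωx∨ω[y∨ωz] (p₀ ∧ω u) (p₁ ∧ω u) (b₀ ∧ω b₁))
... | inj₂ (k , refl , k≰p₀ , k≰p₁)
  with ≤ω-atom-and-≤ω-other⇒≡bot A₀≤u A₀≤p₀ k≰p₀ | ≤ω-atom-and-≤ω-other⇒≡bot A₁≤u A₁≤p₁ k≰p₁
... | refl | refl rewrite x∨ωbot≡x b₀ | x∨ωbot≡x b₁ =
  ≤ω-trans (x∧ωy≤ωx u (p₀ ∨ω p₁)) $ ≤ω-trans (∧ω-greatest u≤b₀∨A u≤b₁∨A) $
    ≤ω-trans (y≤ωx∨ωy (p₁ ∧ω u) (b₀ ∧ω b₁)) (y≤ωx∨ωy (p₀ ∧ω u) _)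

-- Variables: 0 ↦ a₀, 1 ↦ a₁, 2 ↦ b₀, 3 ↦ b₁, 4 ↦ p₀, 5 ↦ p₁; Aᵢ is aᵢ ∧ pᵢ.
law-u law-lhs law-rhs : Term
law-u   = (var 2 ∨ₜ (var 0 ∧ₜ var 4 ∨ₜ var 1 ∧ₜ var 5))
       ∧ₜ (var 3 ∨ₜ (var 0 ∧ₜ var 4 ∨ₜ var 1 ∧ₜ var 5))
law-lhs = law-u ∧ₜ (var 4 ∨ₜ var 5)
law-rhs = var 4 ∧ₜ law-u ∨ₜ (var 5 ∧ₜ law-u ∨ₜ var 2 ∧ₜ var 3)

law-holds-in-Mω : HoldsInMω law-lhs (law-lhs ∧ₜ law-rhs)
law-holds-in-Mω ρ = ≡-sym $ x≤ωy⇒x∧ωy≡x $ Mω-law {b₀ = ρ 2} {b₁ = ρ 3}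
  (x∧ωy≤ωy (ρ 0) (ρ 4)) (x∧ωy≤ωy (ρ 1) (ρ 5))
  (∧ω-greatest (≤ω-trans (x≤ωx∨ωy A₀ A₁) (y≤ωx∨ωy (ρ 2) _))
               (≤ω-trans (x≤ωx∨ωy A₀ A₁) (y≤ωx∨ωy (ρ 3) _)))
  (∧ω-greatest (≤ω-trans (y≤ωx∨ωy A₀ A₁) (y≤ωx∨ωy (ρ 2) _))
               (≤ω-trans (y≤ωx∨ωy A₀ A₁) (y≤ωx∨ωy (ρ 3) _)))
  (x∧ωy≤ωx (ρ 2 ∨ω (A₀ ∨ω A₁)) _) (x∧ωy≤ωy (ρ 2 ∨ω (A₀ ∨ω A₁)) _)
  where
  A₀ A₁ : Mω
  A₀ = ρ 0 ∧ω ρ 4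
  A₁ = ρ 1 ∧ω ρ 5

module _ {c ℓ} (M : Lattice c ℓ) where
  open Lattice M
  open LatticeProperties M using (poset)
  open Poset poset using (_≤_)
  open PosetReasoning poset

  law-in-𝓜ω : InMω M → ∀ {a₀ a₁ b₀ b₁ b₀' b₁' p₀ p₁} →
    a₀ ≤ p₀ → a₁ ≤ p₁ → b₀' ≈ b₀ ∨ a₀ ∨ a₁ → b₁' ≈ b₁ ∨ a₀ ∨ a₁ →
    let u = b₀' ∧ b₁' in
    u ∧ (p₀ ∨ p₁) ≤ p₀ ∧ u ∨ p₁ ∧ u ∨ b₀ ∧ b₁
  law-in-𝓜ω inM {a₀} {a₁} {b₀} {b₁} {b₀'} {b₁'} {p₀} {p₁} a₀≤p₀ a₁≤p₁ b₀'≈ b₁'≈ =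
    begin
      u ∧ (p₀ ∨ p₁)                      ≈⟨ ∧-congʳ u≈ ⟩
      eval M ρ law-lhs                   ≤⟨ inM law-lhs (law-lhs ∧ₜ law-rhs) law-holds-in-Mω ρ ⟩
      eval M ρ law-rhs                   ≈⟨ ∨-cong (∧-congˡ u≈) (∨-congʳ (∧-congˡ u≈)) ⟨
      p₀ ∧ u ∨ p₁ ∧ u ∨ b₀ ∧ b₁          ∎
    where
    u : Carrier
    u = b₀' ∧ b₁'
    ρ : ℕ → Carrier
    ρ 0 = a₀
    ρ 1 = a₁
    ρ 2 = b₀
    ρ 3 = b₁
    ρ 4 = p₀
    ρ 5 = p₁
    ρ _ = a₀
    A≈a₀∨a₁ : a₀ ∧ p₀ ∨ a₁ ∧ p₁ ≈ a₀ ∨ a₁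
    A≈a₀∨a₁ = ∨-cong (sym a₀≤p₀) (sym a₁≤p₁)
    u≈ : u ≈ eval M ρ law-u
    u≈ = ∧-cong (trans b₀'≈ (∨-congˡ (sym A≈a₀∨a₁))) (trans b₁'≈ (∨-congˡ (sym A≈a₀∨a₁)))

lemma5p1 : ∀ {c ℓ} (M : Lattice c ℓ) → InMω M →
    let open Lattice M in
    ∀ (a₀ a₁ b₀ b₁ a₀' a₁' b₀' b₁' : Carrier) →
    Leq M a₀ a₀' → Leq M a₁ a₁' →
    b₀' ≈ b₀ ∨ a₀ ∨ a₁ → b₁' ≈ b₁ ∨ a₀ ∨ a₁ →
    Leq M (b₀ ∧ b₁) (a₀ ∨ a₁) →
    Leq M (b₀' ∧ b₁') (a₀' ∨ a₁') →
    (a₀' ∧ b₀' ∧ b₁') ∨ (a₁' ∧ b₀' ∧ b₁') ≈ b₀' ∧ b₁'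
lemma5p1 M inM a₀ a₁ b₀ b₁ a₀' a₁' b₀' b₁' a₀≤a₀' a₁≤a₁' b₀'≈ b₁'≈ b₀∧b₁≤a u≤a' =
  antisym (∨-least (x∧y≤y a₀' u) (x∧y≤y a₁' u)) $ begin
    u                                   ≈⟨ u≤a' ⟨
    u ∧ (a₀' ∨ a₁')                     ≤⟨ law-in-𝓜ω M inM (sym a₀≤a₀') (sym a₁≤a₁') b₀'≈ b₁'≈ ⟩
    a₀' ∧ u ∨ a₁' ∧ u ∨ b₀ ∧ b₁         ≤⟨ ∨-least (x≤x∨y _ _) (∨-least (y≤x∨y _ _) b₀∧b₁≤X) ⟩
    a₀' ∧ u ∨ a₁' ∧ u                   ∎
  where
  open Lattice M
  open LatticeProperties M using (poset; ∨-∧-isOrderTheoreticLattice)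
  open Poset poset using (_≤_) renaming (reflexive to ≤-reflexive)
  open PosetReasoning poset
  open OrderLattice.IsLattice ∨-∧-isOrderTheoreticLattice
    using (antisym; x≤x∨y; y≤x∨y; ∨-least; x∧y≤y; ∧-greatest)
    renaming (trans to ≤-trans)
  u : Carrier
  u = b₀' ∧ b₁'
  a₀∨a₁≤b : ∀ {b b'} → b' ≈ b ∨ a₀ ∨ a₁ → a₀ ∨ a₁ ≤ b'
  a₀∨a₁≤b b'≈ = ≤-trans (y≤x∨y _ _) (≤-reflexive (sym b'≈))
  a₀∨a₁≤u : a₀ ∨ a₁ ≤ u
  a₀∨a₁≤u = ∧-greatest (a₀∨a₁≤b b₀'≈) (a₀∨a₁≤b b₁'≈)
  b₀∧b₁≤X : b₀ ∧ b₁ ≤ a₀' ∧ u ∨ a₁' ∧ u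
  b₀∧b₁≤X = begin
    b₀ ∧ b₁                 ≈⟨ b₀∧b₁≤a ⟨
    (b₀ ∧ b₁) ∧ (a₀ ∨ a₁)   ≤⟨ x∧y≤y _ _ ⟩
    a₀ ∨ a₁                 ≤⟨ ∨-least
                                 (≤-trans (∧-greatest (sym a₀≤a₀') (≤-trans (x≤x∨y _ _) a₀∨a₁≤u)) (x≤x∨y _ _))
                                 (≤-trans (∧-greatest (sym a₁≤a₁') (≤-trans (y≤x∨y _ _) a₀∨a₁≤u)) (y≤x∨y _ _)) ⟩
    a₀' ∧ u ∨ a₁' ∧ u       ∎
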